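{- (ZF) Let $\mu$ be an infinite regular cardinal. Then $\Phi(\mu,\mu,\mu)$ holds.
   Context: For sets $\lambda_1,\lambda_2$ and an infinite regular cardinal $\mu$, $\Phi(\lambda_1,\lambda_2,\mu)$ is the statement that for every function $f:\lambda_1\times\lambda_2\to\mu$ there are functions $g_1:\lambda_1\to\mu$ and $g_2:\lambda_2\to\mu$ such that for all $(x_1,x_2)\in\lambda_1\times\lambda_2$, $f(x_1,x_2)\le\max\{g_1(x_1),g_2(x_2)\}$. The result is proved in ZF (without the Axiom of Choice). -}

module Defs where

open import Data.Nat using (ℕ)
open import Data.Product using (Σ; _×_; _,_)
open import Data.Sum using (_⊎_)
open import Relation.Binary.Core using (Rel)
open import Relation.Binary.Definitions using (tri<; tri≈; tri>)
open import Relation.Binary.Structures using (IsStrictTotalOrder)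
open import Relation.Binary.PropositionalEquality using (_≡_)
open import Induction.WellFounded using (WellFounded)
open import Function.Definitions using (Injective)

-- An (infinite regular) cardinal μ is represented, as in ZF, by the ordinal μ
-- itself: its elements (the ordinals below μ) form the carrier, ordered by ∈.
record InfiniteRegularCardinal : Set₁ where
  field
    Carrier : Set
    _<_     : Rel Carrier _
    isStrictTotalOrder : IsStrictTotalOrder _≡_ _<_
    wellFounded        : WellFounded _<_
    infinite : Σ (ℕ → Carrier) λ e → Injective _≡_ _≡_ e
    -- regularity (cf μ = μ): every function from an ordinal α < μ into μ
    -- is bounded below μ
    regular : (α : Carrier) (h : Σ Carrier (λ β → β < α) → Carrier) →
              Σ Carrier λ b → ∀ i → h i < b

  _≤_ : Rel Carrier _
  x ≤ y = (x < y) ⊎ (x ≡ y)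

  max : Carrier → Carrier → Carrier
  max x y with IsStrictTotalOrder.compare isStrictTotalOrder x y
  ... | tri< _ _ _ = y
  ... | tri≈ _ _ _ = y
  ... | tri> _ _ _ = x

Φ : (Λ₁ Λ₂ : Set) (μ : InfiniteRegularCardinal) → Set
Φ Λ₁ Λ₂ μ = (f : Λ₁ → Λ₂ → Carrier) →
  Σ (Λ₁ → Carrier) λ g₁ → Σ (Λ₂ → Carrier) λ g₂ →
    ∀ x₁ x₂ → f x₁ x₂ ≤ max (g₁ x₁) (g₂ x₂)
  where open InfiniteRegularCardinal μ

module Submission where

-- Given f : μ × μ → μ, split the square μ × μ along the diagonal.
--   * Below the diagonal (y < x) the row f(x, ·) restricted to the initial
--     segment {y | y < x} is a family indexed by an ordinal x < μ, so by
--     regularity it has a strict upper bound `supBelow x (f x ·)` in μ.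
--   * Above the diagonal (x < y) the column f(·, y) restricted to {x | x < y}
--     is bounded in the same way.
--   * On the diagonal we simply remember the value f(x, x).
-- Hence g₁ x = max (row bound of x) (f x x) and g₂ y = column bound of y
-- work: trichotomy of x and y tells which of the three bounds applies, and
-- max (g₁ x) (g₂ y) lies above each of them.

open import Defs
open InfiniteRegularCardinal using (Carrier)
open import Data.Product using (Σ; _,_; proj₁; proj₂)
open import Relation.Binary.Definitions using (tri<; tri≈; tri>)
open import Relation.Binary.Structures using (IsStrictTotalOrder)
open import Relation.Binary.PropositionalEquality using (_≡_; refl)
import Relation.Binary.Construct.StrictToNonStrict as NonStrict

module _ (μ : InfiniteRegularCardinal) where
  open InfiniteRegularCardinal μ hiding (Carrier)
  open IsStrictTotalOrder isStrictTotalOrder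
    using (compare; isEquivalence; <-resp-≈; trans)
  open NonStrict _≡_ _<_ using (<⇒≤; reflexive)

  private
    A : Set
    A = Carrier μ

  ≤-trans : ∀ {a b c} → a ≤ b → b ≤ c → a ≤ c
  ≤-trans = NonStrict.trans _≡_ _<_ isEquivalence <-resp-≈ trans

  x≤max : ∀ x y → x ≤ max x y
  x≤max x y with compare x y
  ... | tri< x<y _ _ = <⇒≤ x<y
  ... | tri≈ _ x≡y _ = reflexive x≡y
  ... | tri> _ _ _   = reflexive refl

  y≤max : ∀ x y → y ≤ max x y
  y≤max x y with compare x y
  ... | tri< _ _ _   = reflexive refl
  ... | tri≈ _ _ _   = reflexive refl
  ... | tri> _ _ y<x = <⇒≤ y<x

  supBelow : (α : A) → (∀ β → β < α → A) → A
  supBelow α h = proj₁ (regular α (λ (β , β<α) → h β β<α))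

  supBelow-bound : ∀ α (h : ∀ β → β < α → A) β (β<α : β < α) →
                   h β β<α < supBelow α h
  supBelow-bound α h β β<α = proj₂ (regular α (λ (β , β<α) → h β β<α)) (β , β<α)

  rowBound : (A → A → A) → A → A
  rowBound f x = supBelow x (λ y _ → f x y)

  columnBound : (A → A → A) → A → A
  columnBound f y = supBelow y (λ x _ → f x y)

  g₁ : (A → A → A) → A → A
  g₁ f x = max (rowBound f x) (f x x)

  g₂ : (A → A → A) → A → A
  g₂ = columnBound

  covered : ∀ f x y → f x y ≤ max (g₁ f x) (g₂ f y)
  covered f x y with compare y x
  ... | tri< y<x _ _ =
    ≤-trans (<⇒≤ (supBelow-bound x (λ y _ → f x y) y y<x))
      (≤-trans (x≤max (rowBound f x) (f x x)) (x≤max (g₁ f x) (g₂ f y)))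
  ... | tri≈ _ refl _ =
    ≤-trans (y≤max (rowBound f x) (f x x)) (x≤max (g₁ f x) (g₂ f y))
  ... | tri> _ _ x<y =
    ≤-trans (<⇒≤ (supBelow-bound y (λ x _ → f x y) x x<y))
      (y≤max (g₁ f x) (g₂ f y))

mainTheorem1 : (μ : InfiniteRegularCardinal) → Φ (Carrier μ) (Carrier μ) μ
mainTheorem1 μ f = g₁ μ f , g₂ μ f , covered μ f
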